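{- Let $G=(V,E)$ be a chordal graph with finite vertex set $V$, let $\mathscr{C}(G)$ denote the set of non-empty cliques of $G$, and let $c(G)$ denote the number of connected components of $G$. Then for every $r=1,2,3,\dots$, \[ \sum_{\substack{I\in\mathscr{C}(G)\\ |I|\le 2r}} (-1)^{|I|-1} \le c(G), \] with equality if $r\ge |V|/2$.
   Context: A graph is chordal if it contains no induced cycle of length four or more. A clique is a set of pairwise adjacent vertices; $\mathscr{C}(G)$ is the set of all non-empty cliques of $G$ (including single vertices). -}

module Defs where

open import Data.Nat using (ℕ; zero; suc; _+_; _*_; _∸_; _≤_; _≤?_; _%_)
open import Data.Nat.Properties using ()
open import Data.Bool using (Bool; true; false; T; T?)
open import Data.Fin using (Fin; toℕ)
open import Data.Fin.Properties using (all?; _≟_)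
open import Data.Fin.Subset using (Subset; _∈_; ∣_∣; Nonempty)
open import Data.Fin.Subset.Properties using (_∈?_; nonempty?)
open import Data.Integer as ℤ using (ℤ; -1ℤ; 0ℤ)
open import Data.List using (List; []; _∷_; map; filter; foldr; _++_)
open import Data.Vec using (Vec; []; _∷_)
open import Data.Product using (Σ; ∃; _×_; _,_)
open import Data.Sum using (_⊎_)
open import Function using (_⇔_; _∘_)
open import Function.Definitions using (Injective)
open import Relation.Nullary using (Dec; ¬_; yes; no)
open import Relation.Nullary.Decidable using (_×-dec_; _→-dec_; ¬?)
open import Relation.Binary.PropositionalEquality using (_≡_; _≢_)
open import Relation.Binary.Construct.Closure.ReflexiveTransitive using (Star)

record Graph (n : ℕ) : Set where
  field
    adj    : Fin n → Fin n → Bool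
    sym    : ∀ i j → adj i j ≡ adj j i
    irrefl : ∀ i → adj i i ≡ false

open Graph public

Adj : ∀ {n} → Graph n → Fin n → Fin n → Set
Adj G i j = T (adj G i j)

CycleAdj : ∀ m → Fin (suc m) → Fin (suc m) → Set
CycleAdj m i j = (toℕ j ≡ suc (toℕ i) % suc m) ⊎ (toℕ i ≡ suc (toℕ j) % suc m)

InducedCycle : ∀ {n} → Graph n → (m : ℕ) → (Fin (suc (3 + m)) → Fin n) → Set
InducedCycle G m f =
  Injective _≡_ _≡_ f × (∀ i j → Adj G (f i) (f j) ⇔ CycleAdj (3 + m) i j)

Chordal : ∀ {n} → Graph n → Set
Chordal {n} G = ∀ m (f : Fin (suc (3 + m)) → Fin n) → ¬ InducedCycle G m f

IsClique : ∀ {n} → Graph n → Subset n → Set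
IsClique G S = ∀ i j → i ∈ S → j ∈ S → i ≢ j → Adj G i j

isClique? : ∀ {n} (G : Graph n) (S : Subset n) → Dec (IsClique G S)
isClique? G S =
  all? λ i → all? λ j → (i ∈? S) →-dec ((j ∈? S) →-dec ((¬? (i ≟ j)) →-dec T? (adj G i j)))

allSubsets : ∀ n → List (Subset n)
allSubsets zero = [] ∷ []
allSubsets (suc n) = map (false ∷_) (allSubsets n) ++ map (true ∷_) (allSubsets n)

cliquesUpTo : ∀ {n} → Graph n → ℕ → List (Subset n)
cliquesUpTo {n} G k =
  filter (λ S → nonempty? S ×-dec (isClique? G S ×-dec (∣ S ∣ ≤? k))) (allSubsets n)

cliqueSum : ∀ {n} → Graph n → ℕ → ℤ
cliqueSum G k = foldr ℤ._+_ 0ℤ (map (λ S → -1ℤ ℤ.^ (∣ S ∣ ∸ 1)) (cliquesUpTo G k))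

Connected : ∀ {n} → Graph n → Fin n → Fin n → Set
Connected G = Star (Adj G)

-- G has exactly c connected components: there are c representatives,
-- pairwise in different components, and every vertex is connected to one of them.
HasComponents : ∀ {n} → Graph n → ℕ → Set
HasComponents {n} G c =
  Σ (Fin c → Fin n) λ rep →
    (∀ a b → Connected G (rep a) (rep b) → a ≡ b) ×
    (∀ v → ∃ λ a → Connected G v (rep a))

-- For W ⊆ V let χ(W) be the alternating clique sum of G[W] and χ≤k(W) its truncation to
-- cliques of size at most k. Splitting the cliques of G[W + v] by whether they contain v gives
-- χ(W + v) = χ(W) + 1 − χ(W ∩ N(v)) and χ≤(k+1)(W + v) = χ≤(k+1)(W) + 1 − χ≤k(W ∩ N(v)).
-- In a chordal graph two neighbours of v joined by a walk in G[W] are joined inside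
-- G[W ∩ N(v)]: an induced path between them avoiding N(v) would close a chordless cycle
-- through v. So the components of G[W] meeting N(v) match those of G[W ∩ N(v)], adding v
-- changes the number of components by 1 − c(G[W ∩ N(v)]), and by induction χ(W) = c(G[W]) ≥ 0.
-- The same recursion, started from χ≤0 = 0 ≤ χ, puts the even truncations below χ and the odd
-- ones above it; for k ≥ |V| nothing is truncated.

module Submission where

open import Defs
open import Data.Nat using (ℕ; zero; suc; _+_; _*_; _∸_; _%_; _≤_; _<_; _≤?_; _≤ᵇ_; _<ᵇ_; z≤n; s≤s)
open import Data.Nat.DivMod using (m<n⇒m%n≡m; n%n≡0)
import Data.Nat.Properties as ℕ
open import Algebra.Properties.CommutativeSemigroup ℕ.+-commutativeSemigroup using (x∙yz≈y∙xz)
open import Data.Integer as ℤ using (ℤ; 0ℤ; 1ℤ; -1ℤ)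
import Data.Integer.Properties as ℤ
open import Data.Integer.Tactic.RingSolver using (solve-∀)
open import Data.Bool using (Bool; true; false; T; if_then_else_; not; _∧_; _∨_)
open import Data.Bool.Properties using (T-≡; T?)
open import Data.Fin using (Fin; zero; suc; toℕ)
import Data.Fin.Properties as Fin
open import Data.Fin.Subset using (Subset; inside; outside; _∈_; _∉_; _⊆_; _∩_; ⊤; ∣_∣; Nonempty)
open import Data.Fin.Subset.Properties
  using ( _∈?_; _⊆?_; ∈⊤; drop-∷-⊆; out⊆; in⊆in; x∈p∩q⁺; x∈p∩q⁻; nonempty?; Empty-unique
        ; ∣p∣≤n; ∣⊥∣≡0; ∣⁅x⁆∣≡1; x∈⁅y⁆⇒x≡y; p⊆q⇒∣p∣≤∣q∣)
open import Data.Vec using ([]; _∷_; here; there; tabulate)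
open import Data.Vec.Properties using (lookup∘tabulate; []=⇒lookup; lookup⇒[]=)
open import Data.List using (List; []; _∷_; _++_; map; filter; foldr)
import Data.List.Properties as List
open import Data.Product using (Σ; _×_; _,_; proj₁; proj₂; ∃)
open import Data.Sum using (_⊎_; inj₁; inj₂)
open import Data.Empty using (⊥-elim)
open import Function using (id; _∘_; _⇔_; mk⇔; Equivalence; case_of_)
open import Relation.Nullary using (Dec; yes; no; ¬_; does; contradiction)
open import Relation.Binary.Definitions using (tri<; tri≈; tri>)
open import Relation.Binary.Construct.Closure.ReflexiveTransitive using (Star; ε; _◅_; _◅◅_; return; gmap; reverse)
open import Relation.Nullary.Decidable using (_×-dec_; _⊎-dec_; ¬?; does-⇔; dec-true; dec-false)
import Relation.Binary.PropositionalEquality as ≡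
open ≡ using (_≡_; _≢_; refl; trans; cong; cong₂; subst; module ≡-Reasoning)

private
  variable
    n : ℕ

tailGraph : Graph (suc n) → Graph n
tailGraph G = record
  { adj    = λ i j → adj G (suc i) (suc j)
  ; sym    = λ i j → sym G (suc i) (suc j)
  ; irrefl = λ i → irrefl G (suc i)
  }

neighbours₀ : Graph (suc n) → Subset n
neighbours₀ G = tabulate (λ x → adj G zero (suc x))

∈neighbours₀⇔ : ∀ (G : Graph (suc n)) {x} → x ∈ neighbours₀ G ⇔ Adj G zero (suc x)
∈neighbours₀⇔ G {x} = mk⇔
  (λ x∈ → Equivalence.from T-≡ (trans (≡.sym (lookup∘tabulate _ x)) ([]=⇒lookup x∈)))
  (λ a → lookup⇒[]= x _ (trans (lookup∘tabulate _ x) (Equivalence.to T-≡ a)))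

adj-sym : ∀ (G : Graph n) {i j} → Adj G i j → Adj G j i
adj-sym G {i} {j} = subst T (sym G i j)

adj-irrefl : ∀ (G : Graph n) {i} → ¬ Adj G i i
adj-irrefl G {i} = subst T (irrefl G i)

when : ∀ {P : Set} → Dec P → ℤ → ℤ
when p x = if does p then x else 0ℤ

when-yes : ∀ {P : Set} → P → (p? : Dec P) (x : ℤ) → when p? x ≡ x
when-yes p p? x = cong (λ b → if b then x else 0ℤ) (dec-true p? p)

when-no : ∀ {P : Set} → ¬ P → (p? : Dec P) (x : ℤ) → when p? x ≡ 0ℤ
when-no ¬p p? x = cong (λ b → if b then x else 0ℤ) (dec-false p? ¬p)

when-⇔ : ∀ {P Q : Set} → P ⇔ Q → (p? : Dec P) (q? : Dec Q) (x : ℤ) → when p? x ≡ when q? x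
when-⇔ P⇔Q p? q? x = cong (λ b → if b then x else 0ℤ) (does-⇔ P⇔Q p? q?)

when-×-yes : ∀ {P Q : Set} → P → (p? : Dec P) (q? : Dec Q) (x : ℤ) → when (p? ×-dec q?) x ≡ when q? x
when-×-yes p p? q? x = cong (λ b → if b ∧ does q? then x else 0ℤ) (dec-true p? p)

when-zero : ∀ {P : Set} (p? : Dec P) → when p? 0ℤ ≡ 0ℤ
when-zero (yes _) = refl
when-zero (no _)  = refl

when-linear : ∀ {P : Set} (p? : Dec P) (x y : ℤ) → when p? (x ℤ.- y) ≡ when p? x ℤ.- when p? y
when-linear (yes _) x y = refl
when-linear (no _)  x y = refl

does≡true⇒ : ∀ {P : Set} (p? : Dec P) → does p? ≡ true → P
does≡true⇒ (yes p) _ = p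

-- Weighted sums over the cliques of an induced subgraph

sumSubsets : ∀ n → (Subset n → ℤ) → ℤ
sumSubsets zero    h = h []
sumSubsets (suc n) h = sumSubsets n (h ∘ (outside ∷_)) ℤ.+ sumSubsets n (h ∘ (inside ∷_))

sumSubsets-cong : ∀ n {h h′ : Subset n → ℤ} → (∀ S → h S ≡ h′ S) → sumSubsets n h ≡ sumSubsets n h′
sumSubsets-cong zero    eq = eq []
sumSubsets-cong (suc n) eq =
  cong₂ ℤ._+_ (sumSubsets-cong n (eq ∘ (outside ∷_))) (sumSubsets-cong n (eq ∘ (inside ∷_)))

sumSubsets-zero : ∀ n {h : Subset n → ℤ} → (∀ S → h S ≡ 0ℤ) → sumSubsets n h ≡ 0ℤ
sumSubsets-zero zero    eq = eq []
sumSubsets-zero (suc n) eq =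
  cong₂ ℤ._+_ (sumSubsets-zero n (eq ∘ (outside ∷_))) (sumSubsets-zero n (eq ∘ (inside ∷_)))

sumSubsets-linear : ∀ n (h h′ : Subset n → ℤ) →
  sumSubsets n (λ S → h S ℤ.- h′ S) ≡ sumSubsets n h ℤ.- sumSubsets n h′
sumSubsets-linear zero    h h′ = refl
sumSubsets-linear (suc n) h h′ = trans
  (cong₂ ℤ._+_ (sumSubsets-linear n _ _) (sumSubsets-linear n _ _))
  (interchange (sumSubsets n (h ∘ (outside ∷_))) _ _ _)
  where
  interchange : ∀ a b c d → (a ℤ.- b) ℤ.+ (c ℤ.- d) ≡ (a ℤ.+ c) ℤ.- (b ℤ.+ d)
  interchange = solve-∀

sum : List ℤ → ℤ
sum = foldr ℤ._+_ 0ℤ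

sum-++ : ∀ xs ys → sum (xs ++ ys) ≡ sum xs ℤ.+ sum ys
sum-++ []       ys = ≡.sym (ℤ.+-identityˡ _)
sum-++ (x ∷ xs) ys = trans (cong (ℤ._+_ x) (sum-++ xs ys)) (≡.sym (ℤ.+-assoc x _ _))

sum-filter : ∀ {A : Set} {P : A → Set} (P? : ∀ x → Dec (P x)) (f : A → ℤ) xs →
  sum (map f (filter P? xs)) ≡ sum (map (λ x → when (P? x) (f x)) xs)
sum-filter P? f []       = refl
sum-filter P? f (x ∷ xs) with P? x
... | yes _ = cong (ℤ._+_ (f x)) (sum-filter P? f xs)
... | no  _ = trans (sum-filter P? f xs) (≡.sym (ℤ.+-identityˡ _))

sum-allSubsets : ∀ n (h : Subset n → ℤ) → sum (map h (allSubsets n)) ≡ sumSubsets n h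
sum-allSubsets zero    h = ℤ.+-identityʳ _
sum-allSubsets (suc n) h = begin
  sum (map h (map (outside ∷_) A ++ map (inside ∷_) A))
    ≡⟨ cong sum (List.map-++ h (map (outside ∷_) A) _) ⟩
  sum (map h (map (outside ∷_) A) ++ map h (map (inside ∷_) A))
    ≡⟨ sum-++ (map h (map (outside ∷_) A)) _ ⟩
  sum (map h (map (outside ∷_) A)) ℤ.+ sum (map h (map (inside ∷_) A))
    ≡⟨ cong₂ ℤ._+_ (half outside) (half inside) ⟩
  sumSubsets (suc n) h ∎
  where
  open ≡-Reasoning
  A : List (Subset n)
  A = allSubsets n
  half : ∀ s → sum (map h (map (s ∷_) A)) ≡ sumSubsets n (h ∘ (s ∷_))
  half s = trans (cong sum (≡.sym (List.map-∘ A))) (sum-allSubsets n (h ∘ (s ∷_)))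

CliqueIn : Graph n → Subset n → Subset n → Set
CliqueIn G W S = IsClique G S × S ⊆ W

cliqueIn? : ∀ (G : Graph n) W S → Dec (CliqueIn G W S)
cliqueIn? G W S = isClique? G S ×-dec (S ⊆? W)

cliqueWeight : Graph n → Subset n → (ℕ → ℤ) → ℤ
cliqueWeight {n} G W f = sumSubsets n (λ S → when (cliqueIn? G W S) (f ∣ S ∣))

module _ (G : Graph (suc n)) where
  private
    G′ : Graph n
    G′ = tailGraph G

  isClique-outside : ∀ {S} → IsClique G (outside ∷ S) ⇔ IsClique G′ S
  isClique-outside = mk⇔
    (λ c i j i∈ j∈ i≢j → c (suc i) (suc j) (there i∈) (there j∈) (i≢j ∘ Fin.suc-injective))
    (λ { c (suc i) (suc j) (there i∈) (there j∈) i≢j → c i j i∈ j∈ (i≢j ∘ cong suc) })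

  isClique-inside : ∀ {S} → IsClique G (inside ∷ S) ⇔ (IsClique G′ S × S ⊆ neighbours₀ G)
  isClique-inside = mk⇔
    (λ c → (λ i j i∈ j∈ i≢j → c (suc i) (suc j) (there i∈) (there j∈) (i≢j ∘ Fin.suc-injective))
         , (λ {x} x∈ → Equivalence.from (∈neighbours₀⇔ G) (c zero (suc x) here (there x∈) λ ())))
    from
    where
    from : ∀ {S} → IsClique G′ S × S ⊆ neighbours₀ G → IsClique G (inside ∷ S)
    from (c , S⊆N) zero    zero    _          _          i≢j = ⊥-elim (i≢j refl)
    from (c , S⊆N) zero    (suc j) _          (there j∈) _   = Equivalence.to (∈neighbours₀⇔ G) (S⊆N j∈)
    from (c , S⊆N) (suc i) zero    (there i∈) _          _   = adj-sym G (Equivalence.to (∈neighbours₀⇔ G) (S⊆N i∈))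
    from (c , S⊆N) (suc i) (suc j) (there i∈) (there j∈) i≢j = c i j i∈ j∈ (i≢j ∘ cong suc)

  cliqueIn-outside : ∀ {s W S} → CliqueIn G (s ∷ W) (outside ∷ S) ⇔ CliqueIn G′ W S
  cliqueIn-outside = mk⇔
    (λ (c , ⊆) → Equivalence.to isClique-outside c , drop-∷-⊆ ⊆)
    (λ (c , ⊆) → Equivalence.from isClique-outside c , out⊆ ⊆)

  cliqueIn-inside : ∀ {W S} → CliqueIn G (inside ∷ W) (inside ∷ S) ⇔ CliqueIn G′ (W ∩ neighbours₀ G) S
  cliqueIn-inside {W} = mk⇔
    (λ (c , ⊆) → let (c′ , S⊆N) = Equivalence.to isClique-inside c
                 in c′ , λ x∈ → x∈p∩q⁺ (drop-∷-⊆ ⊆ x∈ , S⊆N x∈))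
    (λ (c′ , ⊆) → Equivalence.from isClique-inside (c′ , proj₂ ∘ x∈p∩q⁻ W _ ∘ ⊆)
                , in⊆in (proj₁ ∘ x∈p∩q⁻ W _ ∘ ⊆))

  ¬cliqueIn-inside-outside : ∀ {W S} → ¬ CliqueIn G (outside ∷ W) (inside ∷ S)
  ¬cliqueIn-inside-outside (_ , ⊆) with ⊆ here
  ... | ()

  cliqueWeight-outside : ∀ W f → cliqueWeight G (outside ∷ W) f ≡ cliqueWeight G′ W f
  cliqueWeight-outside W f = trans
    (cong₂ ℤ._+_
      (sumSubsets-cong n λ S → when-⇔ cliqueIn-outside (cliqueIn? G (outside ∷ W) (outside ∷ S)) (cliqueIn? G′ W S) _)
      (sumSubsets-zero n λ S → when-no ¬cliqueIn-inside-outside (cliqueIn? G (outside ∷ W) (inside ∷ S)) _))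
    (ℤ.+-identityʳ _)

  cliqueWeight-inside : ∀ W f → cliqueWeight G (inside ∷ W) f
                              ≡ cliqueWeight G′ W f ℤ.+ cliqueWeight G′ (W ∩ neighbours₀ G) (f ∘ suc)
  cliqueWeight-inside W f = cong₂ ℤ._+_
    (sumSubsets-cong n λ S → when-⇔ cliqueIn-outside (cliqueIn? G (inside ∷ W) (outside ∷ S)) (cliqueIn? G′ W S) _)
    (sumSubsets-cong n λ S → when-⇔ cliqueIn-inside (cliqueIn? G (inside ∷ W) (inside ∷ S)) (cliqueIn? G′ _ S) _)

module _ (G : Graph n) (W : Subset n) where

  cliqueWeight-cong : ∀ {f g : ℕ → ℤ} → (∀ j → j ≤ n → f j ≡ g j) → cliqueWeight G W f ≡ cliqueWeight G W g
  cliqueWeight-cong eq = sumSubsets-cong n λ S → cong (when (cliqueIn? G W S)) (eq ∣ S ∣ (∣p∣≤n S))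

  cliqueWeight-vanishing : ∀ {f : ℕ → ℤ} → (∀ j → f j ≡ 0ℤ) → cliqueWeight G W f ≡ 0ℤ
  cliqueWeight-vanishing eq = sumSubsets-zero n λ S → trans (cong (when (cliqueIn? G W S)) (eq ∣ S ∣)) (when-zero (cliqueIn? G W S))

  cliqueWeight-linear : ∀ (f g : ℕ → ℤ) →
    cliqueWeight G W (λ j → f j ℤ.- g j) ≡ cliqueWeight G W f ℤ.- cliqueWeight G W g
  cliqueWeight-linear f g = trans
    (sumSubsets-cong n λ S → when-linear (cliqueIn? G W S) (f ∣ S ∣) (g ∣ S ∣))
    (sumSubsets-linear n _ _)

δ₀ : ℕ → ℤ
δ₀ zero    = 1ℤ
δ₀ (suc _) = 0ℤ

cliqueWeight-δ₀ : ∀ (G : Graph n) W → cliqueWeight G W δ₀ ≡ 1ℤ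
cliqueWeight-δ₀ {zero}  G [] = when-yes ((λ ()) , λ ()) (cliqueIn? G [] []) 1ℤ
cliqueWeight-δ₀ {suc n} G (outside ∷ W) = trans (cliqueWeight-outside G W δ₀) (cliqueWeight-δ₀ (tailGraph G) W)
cliqueWeight-δ₀ {suc n} G (inside ∷ W)  = begin
  cliqueWeight G (inside ∷ W) δ₀                                      ≡⟨ cliqueWeight-inside G W δ₀ ⟩
  cliqueWeight G′ W δ₀ ℤ.+ cliqueWeight G′ (W ∩ neighbours₀ G) (δ₀ ∘ suc) ≡⟨ cong₂ ℤ._+_ (cliqueWeight-δ₀ G′ W)
                                                                             (cliqueWeight-vanishing G′ (W ∩ neighbours₀ G) λ _ → refl) ⟩
  1ℤ ℤ.+ 0ℤ                                                             ∎
  where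
  open ≡-Reasoning
  G′ : Graph n
  G′ = tailGraph G

cliqueWeight-inside-shifted : ∀ (G : Graph (suc n)) W {f g : ℕ → ℤ} → (∀ j → f (suc j) ≡ δ₀ j ℤ.- g j) →
  cliqueWeight G (inside ∷ W) f ≡ cliqueWeight (tailGraph G) W f ℤ.+ (1ℤ ℤ.- cliqueWeight (tailGraph G) (W ∩ neighbours₀ G) g)
cliqueWeight-inside-shifted {n} G W {f} {g} rec = begin
  cliqueWeight G (inside ∷ W) f                             ≡⟨ cliqueWeight-inside G W f ⟩
  cliqueWeight G′ W f ℤ.+ cliqueWeight G′ H (f ∘ suc)          ≡⟨ cong (ℤ._+_ (cliqueWeight G′ W f)) (begin
    cliqueWeight G′ H (f ∘ suc)                                ≡⟨ cliqueWeight-cong G′ H (λ j _ → rec j) ⟩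
    cliqueWeight G′ H (λ j → δ₀ j ℤ.- g j)                       ≡⟨ cliqueWeight-linear G′ H δ₀ g ⟩
    cliqueWeight G′ H δ₀ ℤ.- cliqueWeight G′ H g                 ≡⟨ cong (ℤ._- cliqueWeight G′ H g) (cliqueWeight-δ₀ G′ H) ⟩
    1ℤ ℤ.- cliqueWeight G′ H g                                   ∎) ⟩
  cliqueWeight G′ W f ℤ.+ (1ℤ ℤ.- cliqueWeight G′ H g)          ∎
  where
  open ≡-Reasoning
  G′ : Graph n
  G′ = tailGraph G
  H : Subset n
  H  = W ∩ neighbours₀ G

-- The sign (-1)^(|I|-1) of a clique of size j = |I|; the empty clique gets weight 0.
euler : ℕ → ℤ
euler zero    = 0ℤ
euler (suc j) = -1ℤ ℤ.^ j

eulerUpTo : ℕ → ℕ → ℤ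
eulerUpTo k j = if j ≤ᵇ k then euler j else 0ℤ

euler-suc : ∀ j → euler (suc j) ≡ δ₀ j ℤ.- euler j
euler-suc zero    = refl
euler-suc (suc j) = trans (ℤ.-1*i≡-i (-1ℤ ℤ.^ j)) (≡.sym (ℤ.+-identityˡ _))

eulerUpTo-suc : ∀ k j → eulerUpTo (suc k) (suc j) ≡ δ₀ j ℤ.- eulerUpTo k j
eulerUpTo-suc k zero    = refl
eulerUpTo-suc k (suc j) with j <ᵇ k
... | true  = trans (ℤ.-1*i≡-i (-1ℤ ℤ.^ j)) (≡.sym (ℤ.+-identityˡ _))
... | false = refl

χ : Graph n → Subset n → ℤ
χ G W = cliqueWeight G W euler

χ≤ : Graph n → Subset n → ℕ → ℤ
χ≤ G W k = cliqueWeight G W (eulerUpTo k)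

χ-inside : ∀ (G : Graph (suc n)) W →
  χ G (inside ∷ W) ≡ χ (tailGraph G) W ℤ.+ (1ℤ ℤ.- χ (tailGraph G) (W ∩ neighbours₀ G))
χ-inside G W = cliqueWeight-inside-shifted G W {euler} {euler} euler-suc

χ≤-inside : ∀ (G : Graph (suc n)) W k →
  χ≤ G (inside ∷ W) (suc k) ≡ χ≤ (tailGraph G) W (suc k) ℤ.+ (1ℤ ℤ.- χ≤ (tailGraph G) (W ∩ neighbours₀ G) k)
χ≤-inside G W k = cliqueWeight-inside-shifted G W {eulerUpTo (suc k)} {eulerUpTo k} (eulerUpTo-suc k)

χ≤-zero : ∀ (G : Graph n) W → χ≤ G W 0 ≡ 0ℤ
χ≤-zero G W = cliqueWeight-vanishing G W {eulerUpTo 0} λ { zero → refl ; (suc j) → refl }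

χ≤-large : ∀ (G : Graph n) W k → n ≤ k → χ≤ G W k ≡ χ G W
χ≤-large G W k n≤k = cliqueWeight-cong G W λ j j≤n →
  cong (λ b → if b then euler j else 0ℤ) (Equivalence.to T-≡ (ℕ.≤⇒≤ᵇ (ℕ.≤-trans j≤n n≤k)))

nonempty⇒∣p∣>0 : ∀ {p : Subset n} → Nonempty p → 0 < ∣ p ∣
nonempty⇒∣p∣>0 {p = p} (x , x∈p) = subst (_≤ ∣ p ∣) (∣⁅x⁆∣≡1 x)
  (p⊆q⇒∣p∣≤∣q∣ λ y∈⁅x⁆ → subst (_∈ p) (≡.sym (x∈⁅y⁆⇒x≡y x y∈⁅x⁆)) x∈p)

cliqueSum≡χ≤ : ∀ (G : Graph n) k → cliqueSum G k ≡ χ≤ G ⊤ k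
cliqueSum≡χ≤ {n} G k = begin
  cliqueSum G k                                           ≡⟨ sum-filter P? sign (allSubsets n) ⟩
  sum (map (λ S → when (P? S) (sign S)) (allSubsets n))    ≡⟨ sum-allSubsets n _ ⟩
  sumSubsets n (λ S → when (P? S) (sign S))                ≡⟨ sumSubsets-cong n (λ S → term (isClique? G S) (nonempty? S)) ⟩
  χ≤ G ⊤ k                                                ∎
  where
  open ≡-Reasoning
  P? : ∀ S → Dec (Nonempty S × IsClique G S × ∣ S ∣ ≤ k)
  P? S = nonempty? S ×-dec (isClique? G S ×-dec (∣ S ∣ ≤? k))
  sign : Subset n → ℤ
  sign S = -1ℤ ℤ.^ (∣ S ∣ ∸ 1)

  sign-agrees : ∀ m → 0 < m → when (m ≤? k) (-1ℤ ℤ.^ (m ∸ 1)) ≡ eulerUpTo k m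
  sign-agrees (suc j) _ = refl

  term : ∀ {S} → Dec (IsClique G S) → Dec (Nonempty S) →
         when (P? S) (sign S) ≡ when (cliqueIn? G ⊤ S) (eulerUpTo k ∣ S ∣)
  term {S} (no ¬c) _ = trans
    (when-no (¬c ∘ proj₁ ∘ proj₂) (P? S) _) (≡.sym (when-no (¬c ∘ proj₁) (cliqueIn? G ⊤ S) _))
  term {S} (yes c) (no ¬ne) = trans
    (when-no (¬ne ∘ proj₁) (P? S) _)
    (≡.sym (trans (when-yes (c , λ {_} _ → ∈⊤) (cliqueIn? G ⊤ S) _)
                  (cong (eulerUpTo k) (trans (cong ∣_∣ (Empty-unique ¬ne)) (∣⊥∣≡0 n)))))
  term {S} (yes c) (yes ne) = begin
    when (P? S) (sign S)                         ≡⟨ when-×-yes ne (nonempty? S) (isClique? G S ×-dec (∣ S ∣ ≤? k)) (sign S) ⟩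
    when (isClique? G S ×-dec (∣ S ∣ ≤? k)) (sign S) ≡⟨ when-×-yes c (isClique? G S) (∣ S ∣ ≤? k) (sign S) ⟩
    when (∣ S ∣ ≤? k) (sign S)                    ≡⟨ sign-agrees ∣ S ∣ (nonempty⇒∣p∣>0 ne) ⟩
    eulerUpTo k ∣ S ∣                            ≡⟨ when-yes (c , λ {_} _ → ∈⊤) (cliqueIn? G ⊤ S) _ ⟨
    when (cliqueIn? G ⊤ S) (eulerUpTo k ∣ S ∣)    ∎

-- Walks, induced paths and neighbourhoods in chordal graphs

Edge : Graph n → (Fin n → Set) → Fin n → Fin n → Set
Edge G P x y = P x × P y × Adj G x y

ConnectedIn : Graph n → Subset n → Fin n → Fin n → Set
ConnectedIn G W = Star (Edge G (_∈ W))

endpoint : ∀ (G : Graph n) (P : Fin n → Set) {x y} → P x → Star (Edge G P) x y → P y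
endpoint G P px ε                      = px
endpoint G P _  ((_ , py , _) ◅ walk) = endpoint G P py walk

record InducedPath (G : Graph n) (L : ℕ) (q : ℕ → Fin n) : Set where
  field
    step      : ∀ t → t < L → Adj G (q t) (q (suc t))
    distinct  : ∀ s t → s < t → t ≤ L → q s ≢ q t
    chordless : ∀ s t → s < t → t ≤ L → Adj G (q s) (q t) → t ≡ suc s

  injective : ∀ s t → s ≤ L → t ≤ L → q s ≡ q t → s ≡ t
  injective s t s≤L t≤L eq with ℕ.<-cmp s t
  ... | tri< s<t _ _ = contradiction eq (distinct s t s<t t≤L)
  ... | tri≈ _ s≡t _ = s≡t
  ... | tri> _ _ t<s = contradiction (≡.sym eq) (distinct t s t<s s≤L)

  adjacent⇒consecutive : ∀ s t → s ≤ L → t ≤ L → Adj G (q s) (q t) → t ≡ suc s ⊎ s ≡ suc t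
  adjacent⇒consecutive s t s≤L t≤L a with ℕ.<-cmp s t
  ... | tri< s<t _ _ = inj₁ (chordless s t s<t t≤L a)
  ... | tri≈ _ refl _ = ⊥-elim (adj-irrefl G a)
  ... | tri> _ _ t<s = inj₂ (chordless t s t<s s≤L (adj-sym G a))

_◂_ : ∀ {A : Set} → A → (ℕ → A) → ℕ → A
(x ◂ q) zero    = x
(x ◂ q) (suc t) = q t

module _ {G : Graph n} where

  drop-inducedPath : ∀ j {K q} → InducedPath G (j + K) q → InducedPath G K (λ t → q (j + t))
  drop-inducedPath j {K} {q} p = record
    { step      = λ t t<K → subst (Adj G (q (j + t)) ∘ q) (≡.sym (ℕ.+-suc j t)) (step (j + t) (ℕ.+-monoʳ-< j t<K))
    ; distinct  = λ s t s<t t≤K → distinct (j + s) (j + t) (ℕ.+-monoʳ-< j s<t) (ℕ.+-monoʳ-≤ j t≤K)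
    ; chordless = λ s t s<t t≤K a → ℕ.+-cancelˡ-≡ j t (suc s)
        (trans (chordless (j + s) (j + t) (ℕ.+-monoʳ-< j s<t) (ℕ.+-monoʳ-≤ j t≤K) a) (≡.sym (ℕ.+-suc j s)))
    }
    where open InducedPath p

  cons-inducedPath : ∀ {K q x} → InducedPath G K q → Adj G x (q 0) →
    (∀ t → t ≤ K → x ≢ q t) → (∀ t → 0 < t → t ≤ K → ¬ Adj G x (q t)) → InducedPath G (suc K) (x ◂ q)
  cons-inducedPath {K} {q} {x} p x~q₀ new far = record { step = step′ ; distinct = distinct′ ; chordless = chordless′ }
    where
    open InducedPath p
    step′ : ∀ t → t < suc K → Adj G ((x ◂ q) t) ((x ◂ q) (suc t))
    step′ zero    _         = x~q₀
    step′ (suc t) (s≤s t<K) = step t t<K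
    distinct′ : ∀ s t → s < t → t ≤ suc K → (x ◂ q) s ≢ (x ◂ q) t
    distinct′ zero    (suc t) _         (s≤s t≤K) = new t t≤K
    distinct′ (suc s) (suc t) (s≤s s<t) (s≤s t≤K) = distinct s t s<t t≤K
    chordless′ : ∀ s t → s < t → t ≤ suc K → Adj G ((x ◂ q) s) ((x ◂ q) t) → t ≡ suc s
    chordless′ zero    (suc zero)    _         _         _ = refl
    chordless′ zero    (suc (suc t)) _         (s≤s t≤K) a = ⊥-elim (far (suc t) (s≤s z≤n) t≤K a)
    chordless′ (suc s) (suc t)       (s≤s s<t) (s≤s t≤K) a = cong suc (chordless s t s<t t≤K a)

lastWhere : ∀ {P : ℕ → Set} → (∀ t → Dec (P t)) → ∀ L → P 0 →
  ∃ λ j → j ≤ L × P j × (∀ t → j < t → t ≤ L → ¬ P t)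
lastWhere P? zero    p₀ = 0 , z≤n , p₀ , λ { t (s≤s _) () }
lastWhere P? (suc L) p₀ with P? (suc L)
... | yes p = suc L , ℕ.≤-refl , p , λ t sL<t t≤sL → contradiction (ℕ.≤-<-trans t≤sL sL<t) (ℕ.<-irrefl refl)
... | no ¬p = let (j , j≤L , pj , after) = lastWhere P? L p₀ in
  j , ℕ.m≤n⇒m≤1+n j≤L , pj , λ t j<t t≤sL → case ℕ.m≤n⇒m<n∨m≡n t≤sL of λ where
    (inj₁ t<sL) → after t j<t (ℕ.m<1+n⇒m≤n t<sL)
    (inj₂ refl) → ¬p

record InducedPathIn (G : Graph n) (P : Fin n → Set) (x y : Fin n) : Set where
  field
    length  : ℕ
    vertex  : ℕ → Fin n
    start   : vertex 0 ≡ x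
    end     : vertex length ≡ y
    induced : InducedPath G length vertex
    within  : ∀ t → t ≤ length → P (vertex t)

module _ {G : Graph n} {P : Fin n → Set} where

  drop-inducedPathIn : ∀ {x y} (p : InducedPathIn G P x y) j → j ≤ InducedPathIn.length p →
    InducedPathIn G P (InducedPathIn.vertex p j) y
  drop-inducedPathIn p j j≤L = record
    { length  = L ∸ j
    ; vertex  = λ t → q (j + t)
    ; start   = cong q (ℕ.+-identityʳ j)
    ; end     = trans (cong q (ℕ.m+[n∸m]≡n j≤L)) end
    ; induced = drop-inducedPath j (subst (λ L → InducedPath G L q) (≡.sym (ℕ.m+[n∸m]≡n j≤L)) induced)
    ; within  = λ t t≤L∸j → within (j + t) (subst (j + t ≤_) (ℕ.m+[n∸m]≡n j≤L) (ℕ.+-monoʳ-≤ j t≤L∸j))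
    }
    where open InducedPathIn p renaming (length to L; vertex to q)

  -- Continue from the last vertex of the path that equals or is adjacent to x.
  prepend-inducedPath : ∀ {x x′ y} → P x → Adj G x x′ → InducedPathIn G P x′ y → InducedPathIn G P x y
  prepend-inducedPath {x} {x′} {y} px x~x′ p = shortcut (lastWhere reaches? L reaches₀)
    where
    open InducedPathIn p renaming (length to L; vertex to q)
    Reaches : ℕ → Set
    Reaches t = x ≡ q t ⊎ Adj G x (q t)
    reaches? : ∀ t → Dec (Reaches t)
    reaches? t = (x Fin.≟ q t) ⊎-dec T? (adj G x (q t))
    reaches₀ : Reaches 0
    reaches₀ = inj₂ (subst (Adj G x) (≡.sym start) x~x′)

    shortcut : (∃ λ j → j ≤ L × Reaches j × (∀ t → j < t → t ≤ L → ¬ Reaches t)) → InducedPathIn G P x y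
    shortcut (j , j≤L , inj₁ x≡qj , _) = subst (λ v → InducedPathIn G P v y) (≡.sym x≡qj) (drop-inducedPathIn p j j≤L)
    shortcut (j , j≤L , inj₂ x~qj , unreached) = record
      { length  = suc (InducedPathIn.length rest)
      ; vertex  = x ◂ InducedPathIn.vertex rest
      ; start   = refl
      ; end     = InducedPathIn.end rest
      ; induced = cons-inducedPath (InducedPathIn.induced rest) (subst (Adj G x) (≡.sym (InducedPathIn.start rest)) x~qj)
                    new (λ t 0<t t≤K → unreached-rest t 0<t t≤K ∘ inj₂)
      ; within  = λ { zero _ → px ; (suc t) (s≤s t≤K) → InducedPathIn.within rest t t≤K }
      }
      where
      rest : InducedPathIn G P (q j) y
      rest = drop-inducedPathIn p j j≤L
      unreached-rest : ∀ t → 0 < t → t ≤ L ∸ j → ¬ Reaches (j + t)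
      unreached-rest t 0<t t≤L∸j = unreached (j + t)
        (subst (_< j + t) (ℕ.+-identityʳ j) (ℕ.+-monoʳ-< j 0<t))
        (subst (j + t ≤_) (ℕ.m+[n∸m]≡n j≤L) (ℕ.+-monoʳ-≤ j t≤L∸j))
      new : ∀ t → t ≤ L ∸ j → x ≢ q (j + t)
      new zero    _   x≡ = adj-irrefl G (subst (Adj G x) (≡.sym (trans x≡ (cong q (ℕ.+-identityʳ j)))) x~qj)
      new (suc t) t≤K    = unreached-rest (suc t) (s≤s z≤n) t≤K ∘ inj₁

  walk⇒inducedPath : ∀ {x y} → P x → Star (Edge G P) x y → InducedPathIn G P x y
  walk⇒inducedPath {x} px ε = record
    { length = 0 ; vertex = λ _ → x ; start = refl ; end = refl
    ; induced = record { step = λ _ () ; distinct = λ { _ _ (s≤s _) () } ; chordless = λ { _ _ (s≤s _) () } }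
    ; within = λ _ _ → px }
  walk⇒inducedPath px ((_ , px′ , x~x′) ◅ walk) = prepend-inducedPath px x~x′ (walk⇒inducedPath px′ walk)

module _ (G : Graph (suc n)) where
  private
    G′ : Graph n
    G′ = tailGraph G
    N : Subset n
    N  = neighbours₀ G

  private
    N⇒adj : ∀ {x} → x ∈ N → Adj G zero (suc x)
    N⇒adj = Equivalence.to (∈neighbours₀⇔ G)

  module CycleThroughZero {m q} (p : InducedPath G′ (2 + m) q) (q₀∈N : q 0 ∈ N) (q_L∈N : q (2 + m) ∈ N)
                          (interior : ∀ t → 0 < t → t < 2 + m → q t ∉ N) where
    open InducedPath p
    L : ℕ
    L = 2 + m
    N′ : ℕ
    N′ = 4 + m
    c : ℕ → Fin (suc n)
    c = zero ◂ (suc ∘ q)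
    -- CycleAdj (3 + m) read on the natural-number indices of the 4 + m cycle vertices.
    Cyclic : ℕ → ℕ → Set
    Cyclic α β = β ≡ suc α % N′ ⊎ α ≡ suc β % N′

    c-injective : ∀ α β → α < N′ → β < N′ → c α ≡ c β → α ≡ β
    c-injective zero    zero    _ _ _ = refl
    c-injective (suc s) (suc t) (s≤s (s≤s s≤L)) (s≤s (s≤s t≤L)) eq =
      cong suc (injective s t s≤L t≤L (Fin.suc-injective eq))

    endpoints-only : ∀ t → t ≤ L → q t ∈ N → t ≡ 0 ⊎ t ≡ L
    endpoints-only zero    _   _   = inj₁ refl
    endpoints-only (suc t) t≤L q∈N with ℕ.m≤n⇒m<n∨m≡n t≤L
    ... | inj₁ t<L = contradiction q∈N (interior (suc t) (s≤s z≤n) t<L)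
    ... | inj₂ t≡L = inj₂ t≡L

    next⇒adj : ∀ α β → α < N′ → β ≡ suc α % N′ → Adj G (c α) (c β)
    next⇒adj α β α<N′ β≡ with ℕ.m≤n⇒m<n∨m≡n α<N′
    ... | inj₁ 1+α<N′ = subst (Adj G (c α) ∘ c) (≡.sym (trans β≡ (m<n⇒m%n≡m 1+α<N′))) (forward α 1+α<N′)
      where
      forward : ∀ α → suc α < N′ → Adj G (c α) (c (suc α))
      forward zero    _                       = N⇒adj q₀∈N
      forward (suc s) (s≤s (s≤s (s≤s s<L))) = step s (s≤s s<L)
    ... | inj₂ refl   = subst (Adj G (c α) ∘ c) (≡.sym (trans β≡ (n%n≡0 N′))) (adj-sym G (N⇒adj q_L∈N))

    cyclic-from-0 : ∀ t → suc t < N′ → Adj G zero (suc (q t)) → Cyclic 0 (suc t)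
    cyclic-from-0 t (s≤s (s≤s t≤L)) a with endpoints-only t t≤L (Equivalence.from (∈neighbours₀⇔ G) a)
    ... | inj₁ refl = inj₁ (≡.sym (m<n⇒m%n≡m {n = N′} (s≤s (s≤s z≤n))))
    ... | inj₂ refl = inj₂ (≡.sym (n%n≡0 N′))

    swap : ∀ {α β} → Cyclic α β → Cyclic β α
    swap (inj₁ e) = inj₂ e
    swap (inj₂ e) = inj₁ e

    adj⇒cyclic : ∀ α β → α < N′ → β < N′ → Adj G (c α) (c β) → Cyclic α β
    adj⇒cyclic zero    zero    _   _   a = ⊥-elim (adj-irrefl G a)
    adj⇒cyclic zero    (suc t) _   β<N a = cyclic-from-0 t β<N a
    adj⇒cyclic (suc s) zero    α<N _   a = swap (cyclic-from-0 s α<N (adj-sym G a))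
    adj⇒cyclic (suc s) (suc t) (s≤s (s≤s s≤L)) (s≤s (s≤s t≤L)) a with adjacent⇒consecutive s t s≤L t≤L a
    ... | inj₁ refl = inj₁ (≡.sym (m<n⇒m%n≡m (s≤s (s≤s t≤L))))
    ... | inj₂ refl = inj₂ (≡.sym (m<n⇒m%n≡m (s≤s (s≤s s≤L))))

    inducedCycle : InducedCycle G m (λ a → c (toℕ a))
    inducedCycle =
      (λ {a} {b} eq → Fin.toℕ-injective (c-injective (toℕ a) (toℕ b) (Fin.toℕ<n a) (Fin.toℕ<n b) eq)) ,
      λ a b → mk⇔ (adj⇒cyclic (toℕ a) (toℕ b) (Fin.toℕ<n a) (Fin.toℕ<n b))
        λ { (inj₁ next) → next⇒adj (toℕ a) (toℕ b) (Fin.toℕ<n a) next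
          ; (inj₂ prev) → adj-sym G (next⇒adj (toℕ b) (toℕ a) (Fin.toℕ<n b) prev) }

  module _ (chordal : Chordal G) where

    inducedPath-between-neighbours : ∀ {L q} → InducedPath G′ L q → q 0 ∈ N → q L ∈ N →
      (∀ t → 0 < t → t < L → q t ∉ N) → L ≤ 1
    inducedPath-between-neighbours {zero}          _ _ _ _ = z≤n
    inducedPath-between-neighbours {suc zero}      _ _ _ _ = s≤s z≤n
    inducedPath-between-neighbours {suc (suc m)} p q₀∈N q_L∈N interior =
      ⊥-elim (chordal m _ (CycleThroughZero.inducedCycle p q₀∈N q_L∈N interior))

    -- An induced path from h to v inside the walk has no interior neighbour of 0, so by
    -- chordality it has length at most 1.
    bridge-closes : ∀ {h v} → h ∈ N → v ∈ N → Star (Edge G′ (λ w → (w ≡ h ⊎ w ∉ N) ⊎ w ≡ v)) h v →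
      h ≡ v ⊎ Adj G′ h v
    bridge-closes {h} {v} h∈N v∈N walk =
      close L q start end induced (inducedPath-between-neighbours induced
        (subst (_∈ N) (≡.sym start) h∈N) (subst (_∈ N) (≡.sym end) v∈N) interior)
      where
      open InducedPathIn (walk⇒inducedPath (inj₁ (inj₁ refl)) walk) renaming (length to L; vertex to q)
      open InducedPath induced using (distinct)
      interior : ∀ t → 0 < t → t < L → q t ∉ N
      interior t 0<t t<L with within t (ℕ.<⇒≤ t<L)
      ... | inj₁ (inj₁ qt≡h) = contradiction (trans start (≡.sym qt≡h)) (distinct 0 t 0<t (ℕ.<⇒≤ t<L))
      ... | inj₁ (inj₂ qt∉N) = qt∉N
      ... | inj₂ qt≡v        = contradiction (trans qt≡v (≡.sym end)) (distinct t L t<L ℕ.≤-refl)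
      close : ∀ L q → q 0 ≡ h → q L ≡ v → InducedPath G′ L q → L ≤ 1 → h ≡ v ⊎ Adj G′ h v
      close zero          q q₀≡h q₀≡v _ _       = inj₁ (trans (≡.sym q₀≡h) q₀≡v)
      close (suc zero)    q q₀≡h q₁≡v p _       = inj₂ (≡.subst₂ (Adj G′) q₀≡h q₁≡v (InducedPath.step p 0 (s≤s z≤n)))
      close (suc (suc _)) _ _    _    _ (s≤s ())

    neighbourhood-connected : ∀ W {x y} → x ∈ W ∩ N → y ∈ W ∩ N → ConnectedIn G′ W x y → ConnectedIn G′ (W ∩ N) x y
    neighbourhood-connected W x∈H y∈H walk = connect x∈H ε walk y∈H
      where
      H : Subset n
      H = W ∩ N
      Bridge : Fin n → Fin n → Set
      Bridge h = Star (Edge G′ (λ w → w ≡ h ⊎ w ∉ N)) h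

      bridge-end : ∀ {h u} → Bridge h u → u ≡ h ⊎ u ∉ N
      bridge-end {h} = endpoint G′ (λ w → w ≡ h ⊎ w ∉ N) (inj₁ refl)

      extend : ∀ {h u w} → Bridge h u → Adj G′ u w → w ∉ N → Bridge h w
      extend bridge u~w w∉N = bridge ◅◅ return (bridge-end bridge , inj₂ w∉N , u~w)

      finish : ∀ {h u w} → Bridge h u → Adj G′ u w → Star (Edge G′ (λ x → (x ≡ h ⊎ x ∉ N) ⊎ x ≡ w)) h w
      finish bridge u~w = gmap id (λ (pa , pb , a) → inj₁ pa , inj₁ pb , a) bridge
                          ◅◅ return (inj₁ (bridge-end bridge) , inj₂ refl , u~w)

      connect : ∀ {h u y} → h ∈ H → Bridge h u → ConnectedIn G′ W u y → y ∈ H → ConnectedIn G′ H h y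
      connect h∈H bridge ε y∈H with bridge-end bridge
      ... | inj₁ refl = ε
      ... | inj₂ y∉N  = contradiction (proj₂ (x∈p∩q⁻ W N y∈H)) y∉N
      connect h∈H bridge (_◅_ {j = w} (_ , w∈W , u~w) walk) y∈H with w ∈? H
      ... | no w∉H  = connect h∈H (extend bridge u~w λ w∈N → w∉H (x∈p∩q⁺ (w∈W , w∈N))) walk y∈H
      ... | yes w∈H with bridge-closes (proj₂ (x∈p∩q⁻ W N h∈H)) (proj₂ (x∈p∩q⁻ W N w∈H)) (finish bridge u~w)
      ...   | inj₁ refl = connect w∈H ε walk y∈H
      ...   | inj₂ h~w  = (h∈H , w∈H , h~w) ◅ connect w∈H ε walk y∈H

-- Counting connected components

count : ∀ {M} → (Fin M → Bool) → ℕ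
count {zero}  _ = 0
count {suc M} p = (if p zero then 1 else 0) + count (p ∘ suc)

count-cong : ∀ {M} {p q : Fin M → Bool} → (∀ a → p a ≡ q a) → count p ≡ count q
count-cong {zero}  _  = refl
count-cong {suc M} eq = cong₂ _+_ (cong (λ b → if b then 1 else 0) (eq zero)) (count-cong (eq ∘ suc))

count-true : ∀ {M} (p : Fin M → Bool) → (∀ a → p a ≡ true) → count p ≡ M
count-true {zero}  p _  = refl
count-true {suc M} p eq rewrite eq zero = cong suc (count-true (p ∘ suc) (eq ∘ suc))

count-false : ∀ M → count {M} (λ _ → false) ≡ 0
count-false zero    = refl
count-false (suc M) = count-false M

count-split : ∀ {M} (p q : Fin M → Bool) → count p ≡ count (λ a → p a ∧ q a) + count (λ a → p a ∧ not (q a))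
count-split {zero}  p q = refl
count-split {suc M} p q with p zero | q zero
... | true  | true  = cong suc (count-split (p ∘ suc) (q ∘ suc))
... | true  | false = trans (cong suc (count-split (p ∘ suc) (q ∘ suc))) (≡.sym (ℕ.+-suc _ _))
... | false | _     = count-split (p ∘ suc) (q ∘ suc)

count-insert : ∀ {M} (p : Fin M → Bool) c → count (λ a → does (c Fin.≟ a) ∨ p a) ≡ (if p c then 0 else 1) + count p
count-insert p zero with p zero
... | true  = refl
... | false = refl
count-insert p (suc c) = begin
  count (λ a → does (suc c Fin.≟ a) ∨ p a)                 ≡⟨ cong (bit (p zero) +_) (count-cong λ a → cong (_∨ p (suc a)) (does-suc a)) ⟩
  bit (p zero) + count (λ a → does (c Fin.≟ a) ∨ p (suc a)) ≡⟨ cong (bit (p zero) +_) (count-insert (p ∘ suc) c) ⟩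
  bit (p zero) + ((if p (suc c) then 0 else 1) + count (p ∘ suc)) ≡⟨ x∙yz≈y∙xz (bit (p zero)) (if p (suc c) then 0 else 1) (count (p ∘ suc)) ⟩
  (if p (suc c) then 0 else 1) + count p                       ∎
  where
  open ≡-Reasoning
  bit : Bool → ℕ
  bit b = if b then 1 else 0
  does-suc : ∀ a → does (suc c Fin.≟ suc a) ≡ does (c Fin.≟ a)
  does-suc a = does-⇔ (mk⇔ Fin.suc-injective (cong suc)) (suc c Fin.≟ suc a) (c Fin.≟ a)

Used : ∀ {M} → (Fin n → Fin M) → Subset n → Fin M → Set
Used l W a = ∃ λ x → x ∈ W × l x ≡ a

used? : ∀ {M} (l : Fin n → Fin M) W a → Dec (Used l W a)
used? l W a = Fin.any? λ x → (x ∈? W) ×-dec (l x Fin.≟ a)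

used : ∀ {M} → (Fin n → Fin M) → Subset n → Fin M → Bool
used l W a = does (used? l W a)

module _ {M} (l : Fin (suc n) → Fin M) (W : Subset n) (a : Fin M) where

  used-outside : used l (outside ∷ W) a ≡ used (l ∘ suc) W a
  used-outside = does-⇔
    (mk⇔ (λ { (suc x , there x∈ , eq) → x , x∈ , eq }) (λ (x , x∈ , eq) → suc x , there x∈ , eq))
    (used? l (outside ∷ W) a) (used? (l ∘ suc) W a)

  used-inside : used l (inside ∷ W) a ≡ does (l zero Fin.≟ a) ∨ used (l ∘ suc) W a
  used-inside = does-⇔
    (mk⇔ (λ { (zero , _ , eq) → inj₁ eq ; (suc x , there x∈ , eq) → inj₂ (x , x∈ , eq) })
         (λ { (inj₁ eq) → zero , here , eq ; (inj₂ (x , x∈ , eq)) → suc x , there x∈ , eq }))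
    (used? l (inside ∷ W) a) ((l zero Fin.≟ a) ⊎-dec used? (l ∘ suc) W a)

count-used-kernel : ∀ {M M′} W (l : Fin n → Fin M) (l′ : Fin n → Fin M′) →
  (∀ {x y} → x ∈ W → y ∈ W → l x ≡ l y ⇔ l′ x ≡ l′ y) → count (used l W) ≡ count (used l′ W)
count-used-kernel {M = M} {M′} [] l l′ _ = trans (count-false M) (≡.sym (count-false M′))
count-used-kernel (outside ∷ W) l l′ ker = begin
  count (used l (outside ∷ W))   ≡⟨ count-cong (used-outside l W) ⟩
  count (used (l ∘ suc) W)       ≡⟨ count-used-kernel W (l ∘ suc) (l′ ∘ suc) (λ x∈ y∈ → ker (there x∈) (there y∈)) ⟩
  count (used (l′ ∘ suc) W)      ≡⟨ count-cong (used-outside l′ W) ⟨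
  count (used l′ (outside ∷ W))  ∎
  where open ≡-Reasoning
count-used-kernel (inside ∷ W) l l′ ker = begin
  count (used l (inside ∷ W))                                   ≡⟨ count-cong (used-inside l W) ⟩
  count (λ a → does (l zero Fin.≟ a) ∨ used (l ∘ suc) W a)      ≡⟨ count-insert (used (l ∘ suc) W) (l zero) ⟩
  (if used (l ∘ suc) W (l zero) then 0 else 1) + count (used (l ∘ suc) W)
    ≡⟨ cong₂ _+_ (cong (λ b → if b then 0 else 1) (does-⇔ repeated (used? (l ∘ suc) W (l zero)) (used? (l′ ∘ suc) W (l′ zero))))
                 (count-used-kernel W (l ∘ suc) (l′ ∘ suc) λ x∈ y∈ → ker (there x∈) (there y∈)) ⟩
  (if used (l′ ∘ suc) W (l′ zero) then 0 else 1) + count (used (l′ ∘ suc) W) ≡⟨ count-insert (used (l′ ∘ suc) W) (l′ zero) ⟨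
  count (λ a → does (l′ zero Fin.≟ a) ∨ used (l′ ∘ suc) W a)    ≡⟨ count-cong (used-inside l′ W) ⟨
  count (used l′ (inside ∷ W))                                  ∎
  where
  open ≡-Reasoning
  repeated : Used (l ∘ suc) W (l zero) ⇔ Used (l′ ∘ suc) W (l′ zero)
  repeated = mk⇔ (λ (x , x∈ , eq) → x , x∈ , Equivalence.to   (ker (there x∈) here) eq)
                 (λ (x , x∈ , eq) → x , x∈ , Equivalence.from (ker (there x∈) here) eq)

module _ {G : Graph n} where

  ConnectedIn-sym : ∀ {W x y} → ConnectedIn G W x y → ConnectedIn G W y x
  ConnectedIn-sym = reverse λ (px , py , x~y) → py , px , adj-sym G x~y

  constant-on-walks : ∀ {W} {A : Set} (f : Fin n → A) → (∀ {x y} → Edge G (_∈ W) x y → f x ≡ f y) →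
    ∀ {x y} → ConnectedIn G W x y → f x ≡ f y
  constant-on-walks f respects ε            = refl
  constant-on-walks f respects (e ◅ walk) = trans (respects e) (constant-on-walks f respects walk)

-- Colours are constant exactly on the components of G[W]; not every colour need be used,
-- so the number of components is the number of colours used on W.
record ComponentLabelling (G : Graph n) (W : Subset n) : Set where
  field
    colours            : ℕ
    colour             : Fin n → Fin colours
    respects-edges     : ∀ {x y} → Edge G (_∈ W) x y → colour x ≡ colour y
    same-colour⇒connected : ∀ {x y} → x ∈ W → y ∈ W → colour x ≡ colour y → ConnectedIn G W x y

  connected⇔same-colour : ∀ {x y} → x ∈ W → y ∈ W → ConnectedIn G W x y ⇔ colour x ≡ colour y
  connected⇔same-colour x∈ y∈ = mk⇔ (constant-on-walks {G = G} {W = W} colour respects-edges) (same-colour⇒connected x∈ y∈)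

  components : ℕ
  components = count (used colour W)

open ComponentLabelling using (components)

components-unique : ∀ {G : Graph n} {W} (L L′ : ComponentLabelling G W) → components L ≡ components L′
components-unique L L′ = count-used-kernel _ (colour L) (colour L′) λ x∈ y∈ →
  mk⇔ (Equivalence.to (connected⇔same-colour L′ x∈ y∈) ∘ Equivalence.from (connected⇔same-colour L x∈ y∈))
      (Equivalence.to (connected⇔same-colour L x∈ y∈) ∘ Equivalence.from (connected⇔same-colour L′ x∈ y∈))
  where open ComponentLabelling

emptyLabelling : ∀ (G : Graph 0) → ComponentLabelling G []
emptyLabelling G = record { colours = 0 ; colour = λ () ; respects-edges = λ { {()} } ; same-colour⇒connected = λ () }

count-used-suc : ∀ {M} (l : Fin n → Fin M) W → count (used (λ x → suc (l x)) W) ≡ count (used l W)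
count-used-suc l W = cong₂ _+_
  (cong (λ b → if b then 1 else 0) (dec-false (used? (λ x → suc (l x)) W zero) λ { (_ , _ , ()) }))
  (count-cong λ a → does-⇔
    (mk⇔ (λ (x , x∈ , eq) → x , x∈ , Fin.suc-injective eq) (λ (x , x∈ , eq) → x , x∈ , cong suc eq))
    (used? (λ x → suc (l x)) W (suc a)) (used? l W a))

collapse : ∀ {M} → Bool → Fin M → Fin (suc M)
collapse true  _ = zero
collapse false a = suc a

collapse≡zero : ∀ {M} b (a : Fin M) → collapse b a ≡ zero → b ≡ true
collapse≡zero true _ _ = refl

collapse≡suc : ∀ {M} b (a a′ : Fin M) → collapse b a ≡ suc a′ → b ≡ false × a ≡ a′
collapse≡suc false _ _ eq = refl , Fin.suc-injective eq

collapse-injective : ∀ {M} b b′ (a a′ : Fin M) → collapse b a ≡ collapse b′ a′ → (b ≡ true × b′ ≡ true) ⊎ a ≡ a′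
collapse-injective true  true  _ _ _  = inj₁ (refl , refl)
collapse-injective false false _ _ eq = inj₂ (Fin.suc-injective eq)

module _ (G : Graph (suc n)) where
  private
    G′ : Graph n
    G′ = tailGraph G
    N : Subset n
    N  = neighbours₀ G

  lift-walk : ∀ {s W x y} → ConnectedIn G′ W x y → ConnectedIn G (s ∷ W) (suc x) (suc y)
  lift-walk = gmap suc λ (px , py , x~y) → there px , there py , x~y

  skip-zero : ∀ {W} → ComponentLabelling G′ W → ComponentLabelling G (outside ∷ W)
  skip-zero {W} L = record
    { colours               = suc colours
    ; colour                = colour′
    ; respects-edges        = λ { {suc x} {suc y} (there x∈ , there y∈ , x~y) → cong suc (respects-edges (x∈ , y∈ , x~y)) }
    ; same-colour⇒connected = λ { (there x∈) (there y∈) eq → lift-walk (same-colour⇒connected x∈ y∈ (Fin.suc-injective eq)) }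
    }
    where
    open ComponentLabelling L
    colour′ : Fin (suc n) → Fin (suc colours)
    colour′ zero    = zero
    colour′ (suc x) = suc (colour x)

  components-skip-zero : ∀ {W} (L : ComponentLabelling G′ W) → components (skip-zero L) ≡ components L
  components-skip-zero {W} L = trans (count-cong (used-outside (ComponentLabelling.colour (skip-zero L)) W))
                                     (count-used-suc (ComponentLabelling.colour L) W)

  -- The components of G′[W] meeting N(0) merge with 0 into one component, coloured zero.
  module JoinZero {W} (L : ComponentLabelling G′ W) where
    open ComponentLabelling L hiding (components)
    touched : Fin colours → Bool
    touched = used colour (W ∩ N)
    colour′ : Fin (suc n) → Fin (suc colours)
    colour′ zero    = zero
    colour′ (suc x) = collapse (touched (colour x)) (colour x)

    neighbour-touched : ∀ {y} → y ∈ W → Adj G zero (suc y) → zero ≡ colour′ (suc y)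
    neighbour-touched {y} y∈W 0~y = cong (λ b → collapse b (colour y)) (≡.sym
      (dec-true (used? colour (W ∩ N) (colour y)) (y , x∈p∩q⁺ (y∈W , Equivalence.from (∈neighbours₀⇔ G) 0~y) , refl)))

    respects : ∀ {x y} → Edge G (_∈ inside ∷ W) x y → colour′ x ≡ colour′ y
    respects {zero}  {zero}  _                            = refl
    respects {zero}  {suc y} (_ , there y∈ , 0~y)           = neighbour-touched y∈ 0~y
    respects {suc x} {zero}  (there x∈ , _ , x~0)           = ≡.sym (neighbour-touched x∈ (adj-sym G x~0))
    respects {suc x} {suc y} (there x∈ , there y∈ , x~y) =
      cong (λ a → collapse (touched a) a) (respects-edges (x∈ , y∈ , x~y))

    witness : ∀ {a} → touched a ≡ true → Used colour (W ∩ N) a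
    witness {a} = does≡true⇒ (used? colour (W ∩ N) a)

    reach-zero : ∀ {y} → y ∈ W → touched (colour y) ≡ true → ConnectedIn G (inside ∷ W) zero (suc y)
    reach-zero y∈W t with witness t
    ... | h , h∈H , same = (here , there h∈W , Equivalence.to (∈neighbours₀⇔ G) h∈N) ◅ lift-walk (same-colour⇒connected h∈W y∈W same)
      where
      h∈W : h ∈ W
      h∈W = proj₁ (x∈p∩q⁻ W N h∈H)
      h∈N : h ∈ N
      h∈N = proj₂ (x∈p∩q⁻ W N h∈H)

    connected : ∀ {x y} → x ∈ inside ∷ W → y ∈ inside ∷ W → colour′ x ≡ colour′ y → ConnectedIn G (inside ∷ W) x y
    connected {zero}  {zero}  _          _          _  = ε
    connected {zero}  {suc y} _          (there y∈) eq = reach-zero y∈ (collapse≡zero (touched (colour y)) (colour y) (≡.sym eq))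
    connected {suc x} {zero}  (there x∈) _          eq = ConnectedIn-sym {G = G} (reach-zero x∈ (collapse≡zero (touched (colour x)) (colour x) eq))
    connected {suc x} {suc y} (there x∈) (there y∈) eq with collapse-injective (touched (colour x)) (touched (colour y)) (colour x) (colour y) eq
    ... | inj₁ (tx , ty) = ConnectedIn-sym {G = G} (reach-zero x∈ tx) ◅◅ reach-zero y∈ ty
    ... | inj₂ same      = lift-walk (same-colour⇒connected x∈ y∈ same)

    labelling : ComponentLabelling G (inside ∷ W)
    labelling = record
      { colours = suc colours ; colour = colour′ ; respects-edges = respects ; same-colour⇒connected = connected }

    used-suc : ∀ a → used (colour′ ∘ suc) W (suc a) ≡ used colour W a ∧ not (touched a)
    used-suc a = does-⇔ (mk⇔ to from) (used? (colour′ ∘ suc) W (suc a)) (used? colour W a ×-dec ¬? (used? colour (W ∩ N) a))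
      where
      to : Used (colour′ ∘ suc) W (suc a) → Used colour W a × ¬ Used colour (W ∩ N) a
      to (x , x∈W , eq) with collapse≡suc (touched (colour x)) (colour x) a eq
      ... | untouched , refl = (x , x∈W , refl) , λ u → contradiction (trans (≡.sym (dec-true (used? colour (W ∩ N) (colour x)) u)) untouched) λ ()
      from : Used colour W a × ¬ Used colour (W ∩ N) a → Used (colour′ ∘ suc) W (suc a)
      from ((x , x∈W , refl) , ¬u) = x , x∈W , cong (λ b → collapse b (colour x)) (dec-false (used? colour (W ∩ N) (colour x)) ¬u)

    touched⇒used : ∀ a → used colour W a ∧ touched a ≡ touched a
    touched⇒used a = does-⇔ (mk⇔ proj₂ λ u@(x , x∈H , eq) → (x , proj₁ (x∈p∩q⁻ W N x∈H) , eq) , u)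
      (used? colour W a ×-dec used? colour (W ∩ N) a) (used? colour (W ∩ N) a)

    components-labelling : components labelling + count touched ≡ suc (components L)
    components-labelling = begin
      components labelling + count touched                                        ≡⟨ cong (_+ count touched) (count-cong (used-inside colour′ W)) ⟩
      suc (count (λ a → used (colour′ ∘ suc) W (suc a))) + count touched          ≡⟨ cong (λ k → suc k + count touched) (count-cong used-suc) ⟩
      suc (count (λ a → used colour W a ∧ not (touched a))) + count touched       ≡⟨ cong suc (ℕ.+-comm _ (count touched)) ⟩
      suc (count touched + count (λ a → used colour W a ∧ not (touched a)))       ≡⟨ cong (λ k → suc (k + count (λ a → used colour W a ∧ not (touched a)))) (count-cong touched⇒used) ⟨
      suc (count (λ a → used colour W a ∧ touched a) + count (λ a → used colour W a ∧ not (touched a))) ≡⟨ cong suc (count-split (used colour W) touched) ⟨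
      suc (components L)                                                          ∎
      where open ≡-Reasoning

  restrict-to-neighbourhood : Chordal G → ∀ {W} → ComponentLabelling G′ W → ComponentLabelling G′ (W ∩ N)
  restrict-to-neighbourhood chordal {W} L = record
    { colours               = colours
    ; colour                = colour
    ; respects-edges        = λ (x∈H , y∈H , x~y) → respects-edges (in-W x∈H , in-W y∈H , x~y)
    ; same-colour⇒connected = λ x∈H y∈H eq →
        neighbourhood-connected G chordal W x∈H y∈H (same-colour⇒connected (in-W x∈H) (in-W y∈H) eq)
    }
    where
    open ComponentLabelling L
    in-W : ∀ {x} → x ∈ W ∩ N → x ∈ W
    in-W = proj₁ ∘ x∈p∩q⁻ W N

componentLabelling : ∀ (G : Graph n) W → ComponentLabelling G W
componentLabelling {zero}  G []            = emptyLabelling G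
componentLabelling {suc n} G (outside ∷ W) = skip-zero G (componentLabelling (tailGraph G) W)
componentLabelling {suc n} G (inside ∷ W)  = JoinZero.labelling G (componentLabelling (tailGraph G) W)

chordal-tail : ∀ (G : Graph (suc n)) → Chordal G → Chordal (tailGraph G)
chordal-tail G chordal m f (f-injective , f-cycle) = chordal m (suc ∘ f) (f-injective ∘ Fin.suc-injective , f-cycle)

χ≡components-canonical : ∀ (G : Graph n) → Chordal G → ∀ W → χ G W ≡ ℤ.+ components (componentLabelling G W)
χ≡components-canonical {zero}  G _       []            = refl
χ≡components-canonical {suc n} G chordal (outside ∷ W) = begin
  χ G (outside ∷ W)                                ≡⟨ cliqueWeight-outside G W euler ⟩
  χ (tailGraph G) W                                ≡⟨ χ≡components-canonical (tailGraph G) (chordal-tail G chordal) W ⟩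
  ℤ.+ components (componentLabelling (tailGraph G) W) ≡⟨ cong ℤ.+_ (components-skip-zero G (componentLabelling (tailGraph G) W)) ⟨
  ℤ.+ components (componentLabelling G (outside ∷ W)) ∎
  where open ≡-Reasoning
χ≡components-canonical {suc n} G chordal (inside ∷ W) = begin
  χ G (inside ∷ W)                         ≡⟨ χ-inside G W ⟩
  χ G′ W ℤ.+ (1ℤ ℤ.- χ G′ (W ∩ N))          ≡⟨ cong₂ (λ a b → a ℤ.+ (1ℤ ℤ.- b)) (χ≡components-canonical G′ chordal′ W) χ-H ⟩
  ℤ.+ components L ℤ.+ (1ℤ ℤ.- ℤ.+ count touched) ≡⟨ rearrange (JoinZero.components-labelling G L) ⟨
  ℤ.+ components (JoinZero.labelling G L)  ∎
  where
  open ≡-Reasoning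
  G′ : Graph n
  G′ = tailGraph G
  N : Subset n
  N = neighbours₀ G
  chordal′ : Chordal G′
  chordal′ = chordal-tail G chordal
  L = componentLabelling G′ W
  open JoinZero G L using (touched)
  χ-H : χ G′ (W ∩ N) ≡ ℤ.+ count touched
  χ-H = trans (χ≡components-canonical G′ chordal′ (W ∩ N))
              (cong ℤ.+_ (components-unique (componentLabelling G′ (W ∩ N)) (restrict-to-neighbourhood G chordal L)))
  rearrange : ∀ {a b c} → a + b ≡ suc c → ℤ.+ a ≡ ℤ.+ c ℤ.+ (1ℤ ℤ.- ℤ.+ b)
  rearrange {a} {b} {c} eq = begin
    ℤ.+ a                             ≡⟨ add-sub (ℤ.+ a) (ℤ.+ b) ⟩
    (ℤ.+ a ℤ.+ ℤ.+ b) ℤ.- ℤ.+ b        ≡⟨ cong (ℤ._- ℤ.+ b) (trans (cong ℤ.+_ (≡.sym eq)) (ℤ.pos-+ a b)) ⟨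
    ℤ.+ suc c ℤ.- ℤ.+ b               ≡⟨ cong (ℤ._- ℤ.+ b) (ℤ.pos-+ 1 c) ⟩
    (1ℤ ℤ.+ ℤ.+ c) ℤ.- ℤ.+ b           ≡⟨ shuffle (ℤ.+ c) (ℤ.+ b) ⟩
    ℤ.+ c ℤ.+ (1ℤ ℤ.- ℤ.+ b)           ∎
    where
    add-sub : ∀ x y → x ≡ (x ℤ.+ y) ℤ.- y
    add-sub = solve-∀
    shuffle : ∀ x y → (1ℤ ℤ.+ x) ℤ.- y ≡ x ℤ.+ (1ℤ ℤ.- y)
    shuffle = solve-∀

χ≡components : ∀ (G : Graph n) → Chordal G → ∀ W (L : ComponentLabelling G W) → χ G W ≡ ℤ.+ components L
χ≡components G chordal W L = trans (χ≡components-canonical G chordal W) (cong ℤ.+_ (components-unique (componentLabelling G W) L))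

χ-nonnegative : ∀ (G : Graph n) → Chordal G → ∀ W → 0ℤ ℤ.≤ χ G W
χ-nonnegative G chordal W = subst (0ℤ ℤ.≤_) (≡.sym (χ≡components-canonical G chordal W)) (ℤ.+≤+ z≤n)

-- Truncated sums alternate around χ

private
  step-mono : ∀ {a a′ b b′} → a ℤ.≤ a′ → b′ ℤ.≤ b → a ℤ.+ (1ℤ ℤ.- b) ℤ.≤ a′ ℤ.+ (1ℤ ℤ.- b′)
  step-mono a≤a′ b′≤b = ℤ.+-mono-≤ a≤a′ (ℤ.+-monoʳ-≤ 1ℤ (ℤ.neg-mono-≤ b′≤b))

mutual
  χ≤-even : ∀ (G : Graph n) → Chordal G → ∀ r W → χ≤ G W (r * 2) ℤ.≤ χ G W
  χ≤-even G chordal zero W = subst (ℤ._≤ χ G W) (≡.sym (χ≤-zero G W)) (χ-nonnegative G chordal W)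
  χ≤-even G chordal (suc r) [] = ℤ.≤-reflexive (χ≤-large G [] (suc r * 2) z≤n)
  χ≤-even G chordal (suc r) (outside ∷ W) =
    ≡.subst₂ ℤ._≤_ (≡.sym (cliqueWeight-outside G W (eulerUpTo (suc r * 2)))) (≡.sym (cliqueWeight-outside G W euler))
      (χ≤-even (tailGraph G) (chordal-tail G chordal) (suc r) W)
  χ≤-even G chordal (suc r) (inside ∷ W) =
    ≡.subst₂ ℤ._≤_ (≡.sym (χ≤-inside G W (suc (r * 2)))) (≡.sym (χ-inside G W))
      (step-mono (χ≤-even (tailGraph G) (chordal-tail G chordal) (suc r) W)
                 (χ≤-odd (tailGraph G) (chordal-tail G chordal) r (W ∩ neighbours₀ G)))

  χ≤-odd : ∀ (G : Graph n) → Chordal G → ∀ r W → χ G W ℤ.≤ χ≤ G W (suc (r * 2))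
  χ≤-odd G chordal r [] = ℤ.≤-reflexive (≡.sym (χ≤-large G [] (suc (r * 2)) z≤n))
  χ≤-odd G chordal r (outside ∷ W) =
    ≡.subst₂ ℤ._≤_ (≡.sym (cliqueWeight-outside G W euler)) (≡.sym (cliqueWeight-outside G W (eulerUpTo (suc (r * 2)))))
      (χ≤-odd (tailGraph G) (chordal-tail G chordal) r W)
  χ≤-odd G chordal r (inside ∷ W) =
    ≡.subst₂ ℤ._≤_ (≡.sym (χ-inside G W)) (≡.sym (χ≤-inside G W (r * 2)))
      (step-mono (χ≤-odd (tailGraph G) (chordal-tail G chordal) r W)
                 (χ≤-even (tailGraph G) (chordal-tail G chordal) r (W ∩ neighbours₀ G)))

hasComponents⇒labelling : ∀ {G : Graph n} {c} → HasComponents G c →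
  Σ (ComponentLabelling G ⊤) λ L → components L ≡ c
hasComponents⇒labelling {n} {G} {c} (rep , separated , covered) = L , all-used
  where
  colour : Fin n → Fin c
  colour x = proj₁ (covered x)
  symmetric : ∀ {x y} → Connected G x y → Connected G y x
  symmetric = reverse (adj-sym G)
  L : ComponentLabelling G ⊤
  L = record
    { colours               = c
    ; colour                = colour
    ; respects-edges        = λ {x} {y} (_ , _ , x~y) →
        separated _ _ (symmetric (proj₂ (covered x)) ◅◅ x~y ◅ proj₂ (covered y))
    ; same-colour⇒connected = λ {x} {y} _ _ same → gmap id (λ x~y → ∈⊤ , ∈⊤ , x~y)
        (proj₂ (covered x) ◅◅ subst (λ a → Connected G (rep a) y) (≡.sym same) (symmetric (proj₂ (covered y))))
    }
  all-used : components L ≡ c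
  all-used = count-true (used colour ⊤) λ a →
    dec-true (used? colour ⊤ a) (rep a , ∈⊤ , ≡.sym (separated a (colour (rep a)) (proj₂ (covered (rep a)))))

proposition2 : ∀ {n} (G : Graph n) → Chordal G → (c : ℕ) → HasComponents G c →
    (r : ℕ) → 1 ≤ r →
    (cliqueSum G (2 * r) ℤ.≤ ℤ.+ c) × (n ≤ 2 * r → cliqueSum G (2 * r) ≡ ℤ.+ c)
proposition2 {n} G chordal c components-c r _ = upper-bound , exact
  where
  χ≡c : χ G ⊤ ≡ ℤ.+ c
  χ≡c = let (L , L-count) = hasComponents⇒labelling components-c in
        trans (χ≡components G chordal ⊤ L) (cong ℤ.+_ L-count)
  upper-bound : cliqueSum G (2 * r) ℤ.≤ ℤ.+ c
  upper-bound = ≡.subst₂ ℤ._≤_ (≡.sym (cliqueSum≡χ≤ G (2 * r))) χ≡c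
    (subst (λ k → χ≤ G ⊤ k ℤ.≤ χ G ⊤) (ℕ.*-comm r 2) (χ≤-even G chordal r ⊤))
  exact : n ≤ 2 * r → cliqueSum G (2 * r) ≡ ℤ.+ c
  exact n≤2r = trans (cliqueSum≡χ≤ G (2 * r)) (trans (χ≤-large G ⊤ (2 * r) n≤2r) χ≡c)
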